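{- Let $n \ge 1$, $k$ a positive integer with $k \le n$, and $s_1,\ldots,s_n \in [0,1]$ with $S = \sum_i s_i < k$. Run the following procedure: set $p_i = s_i + (k - S)/n$ for all $i$; while there is an index $i$ with $p_i > 1$: let $\mathcal{S}_{<1} = \{j : p_j < 1\}$, add $(p_i - 1)/|\mathcal{S}_{<1}|$ to $p_j$ for every $j \in \mathcal{S}_{<1}$, and set $p_i = 1$. Writing the final values as $p_i = s_i + \alpha_i$, we have $p_i \ge s_i$ for all $i$, and there is a value $v$ such that $\alpha_j = v$ for every $j$ with final $p_j < 1$.
   Formalization: The values $s_1,\ldots,s_n$ are rational numbers in [0,1], so the values $p_i$ produced by the procedure are rational as well. -}

module Defs where

open import Data.Nat as ℕ using (ℕ; zero; suc; NonZero)
open import Data.Integer using (+_)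
open import Data.Fin using (Fin; zero; suc; _≟_)
open import Data.Rational using (ℚ; _/_; _+_; _-_; _*_; _<_; 0ℚ; 1ℚ)
open import Data.Rational.Properties using (_<?_)
open import Relation.Nullary using (yes; no; ¬_)
open import Relation.Binary.PropositionalEquality using (_≡_)

State : ℕ → Set
State n = Fin n → ℚ

sumℚ : ∀ {n} → (Fin n → ℚ) → ℚ
sumℚ {zero}  s = 0ℚ
sumℚ {suc n} s = s zero + sumℚ (λ i → s (suc i))

ℕ→ℚ : ℕ → ℚ
ℕ→ℚ k = + k / 1

countLt1 : ∀ {n} → State n → ℕ
countLt1 {zero}  p = 0
countLt1 {suc n} p with p zero <? 1ℚ
... | yes _ = suc (countLt1 (λ i → p (suc i)))
... | no  _ = countLt1 (λ i → p (suc i))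

initial : (n : ℕ) → .{{NonZero n}} → ℕ → (Fin n → ℚ) → State n
initial n k s i = s i + (ℕ→ℚ k - sumℚ s) * (+ 1 / n)

-- one iteration of the loop at chosen index i (with p i > 1), where
-- c = |S_{<1}| (given as suc m, so that division is defined):
--   p j += (p i - 1)/c for j with p j < 1 ;  p i := 1
update : ∀ {n} → State n → Fin n → (m : ℕ) → State n
update p i m j with j ≟ i
... | yes _ = 1ℚ
... | no  _ with p j <? 1ℚ
...   | yes _ = p j + (p i - 1ℚ) * (+ 1 / suc m)
...   | no  _ = p j

data Step {n : ℕ} (p q : State n) : Set where
  step : (i : Fin n) → 1ℚ < p i → (m : ℕ) → countLt1 p ≡ suc m →
         (∀ j → q j ≡ update p i m j) → Step p q

Final : ∀ {n} → State n → Set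
Final p = ∀ i → ¬ (1ℚ < p i)

{-# OPTIONS --safe #-}
-- Loop invariant: p ≥ s entrywise, and every entry below 1 exceeds sᵢ by one
-- common amount v. Initially pᵢ = sᵢ + v with v = (k - S)/n ≥ 0. An iteration
-- sets pᵢ := 1 ≥ sᵢ, leaves the other entries ≥ 1 alone, and adds the same
-- nonnegative share (pᵢ - 1)/|S_{<1}| to every entry below 1, so the invariant
-- persists with v increased by that share.
module Submission where

open import Defs
open import Data.Nat using (ℕ; NonZero; suc)
open import Data.Fin using (Fin; _≟_)
open import Data.Integer using (+_)
open import Data.Rational using (ℚ; _+_; _-_; _*_; _/_; -_; _<_; _≤_; 0ℚ; 1ℚ)
open import Data.Rational.Properties
  using (_<?_; +-0-abelianGroup; +-0-commutativeMonoid; +-monoʳ-≤; +-monoˡ-≤;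
         +-identityʳ; +-inverseʳ; *-zeroˡ; *-monoʳ-≤-nonNeg; normalize-nonNeg; <⇒≤; <-irrefl; ≤-trans)
open import Algebra.Properties.AbelianGroup +-0-abelianGroup using (xyx⁻¹≈y)
open import Algebra.Bundles using (CommutativeMonoid)
open import Algebra.Properties.CommutativeSemigroup
  (CommutativeMonoid.commutativeSemigroup +-0-commutativeMonoid) using (xy∙z≈xz∙y)
open import Data.Product using (_×_; _,_; ∃; proj₁; proj₂)
open import Function using (_∘_; id)
open import Relation.Nullary using (yes; no; ¬_; contradiction)
open import Relation.Binary.PropositionalEquality using (_≡_; refl; sym; trans; cong; subst)
open import Relation.Binary.Construct.Closure.ReflexiveTransitive using (Star; fold)

p≤p+q : ∀ p {q} → 0ℚ ≤ q → p ≤ p + q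
p≤p+q p {q} 0≤q = subst (_≤ p + q) (+-identityʳ p) (+-monoʳ-≤ p 0≤q)

p≤q⇒0≤q-p : ∀ {p q} → p ≤ q → 0ℚ ≤ q - p
p≤q⇒0≤q-p {p} {q} p≤q = subst (_≤ q - p) (+-inverseʳ p) (+-monoˡ-≤ (- p) p≤q)

0≤p⇒0≤p/n : ∀ {p} n .{{_ : NonZero n}} → 0ℚ ≤ p → 0ℚ ≤ p * (+ 1 / n)
0≤p⇒0≤p/n {p} n 0≤p =
  subst (_≤ p * (+ 1 / n)) (*-zeroˡ (+ 1 / n))
        (*-monoʳ-≤-nonNeg (+ 1 / n) {{normalize-nonNeg 1 n}} 0≤p)

LiftedBy : ℚ → ℚ → ℚ → Set
LiftedBy v a x = a ≤ x × (x < 1ℚ → x - a ≡ v)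

liftedBy-+ : ∀ {v} a → 0ℚ ≤ v → LiftedBy v a (a + v)
liftedBy-+ a 0≤v = p≤p+q a 0≤v , λ _ → xyx⁻¹≈y a _

liftedBy-1 : ∀ {v a} → a ≤ 1ℚ → LiftedBy v a 1ℚ
liftedBy-1 a≤1 = a≤1 , λ 1<1 → contradiction 1<1 (<-irrefl refl)

liftedBy-raise : ∀ {v a x d} → 0ℚ ≤ d → x < 1ℚ → LiftedBy v a x → LiftedBy (v + d) a (x + d)
liftedBy-raise {v} {a} {x} {d} 0≤d x<1 (a≤x , x-a≡v) =
  ≤-trans a≤x (p≤p+q x 0≤d) ,
  λ _ → trans (xy∙z≈xz∙y x d (- a)) (cong (_+ d) (x-a≡v x<1))

liftedBy-≮1 : ∀ {v w a x} → ¬ x < 1ℚ → LiftedBy v a x → LiftedBy w a x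
liftedBy-≮1 x≮1 (a≤x , _) = a≤x , λ x<1 → contradiction x<1 x≮1

UniformLift : ∀ {n} → (Fin n → ℚ) → State n → Set
UniformLift s p = ∃ λ v → ∀ j → LiftedBy v (s j) (p j)

uniformLift-initial : ∀ n .{{_ : NonZero n}} k (s : Fin n → ℚ) →
                      sumℚ s ≤ ℕ→ℚ k → UniformLift s (initial n k s)
uniformLift-initial n k s S≤k =
  _ , λ j → liftedBy-+ (s j) (0≤p⇒0≤p/n n (p≤q⇒0≤q-p S≤k))

uniformLift-update : ∀ {n} {s : Fin n → ℚ} {p : State n} {i} m → (∀ j → s j ≤ 1ℚ) →
                     1ℚ < p i → UniformLift s p → UniformLift s (update p i m)
uniformLift-update {s = s} {p} {i} m s≤1 1<pᵢ (v , lifted) = v + share , lifted′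
  where
  share : ℚ
  share = (p i - 1ℚ) * (+ 1 / suc m)

  lifted′ : ∀ j → LiftedBy (v + share) (s j) (update p i m j)
  lifted′ j with j ≟ i
  ... | yes _ = liftedBy-1 (s≤1 j)
  ... | no _ with p j <? 1ℚ
  ...   | yes pⱼ<1 = liftedBy-raise (0≤p⇒0≤p/n (suc m) (p≤q⇒0≤q-p (<⇒≤ 1<pᵢ))) pⱼ<1 (lifted j)
  ...   | no pⱼ≮1 = liftedBy-≮1 pⱼ≮1 (lifted j)

uniformLift-step : ∀ {n} {s : Fin n → ℚ} {p q : State n} → (∀ j → s j ≤ 1ℚ) →
                   Step p q → UniformLift s p → UniformLift s q
uniformLift-step {s = s} s≤1 (step i 1<pᵢ m _ q≡update) lift
  with uniformLift-update m s≤1 1<pᵢ lift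
... | v , lifted = v , λ j → subst (LiftedBy v (s j)) (sym (q≡update j)) (lifted j)

uniformLift-star : ∀ {n} {s : Fin n → ℚ} {p q : State n} → (∀ j → s j ≤ 1ℚ) →
                   Star Step p q → UniformLift s p → UniformLift s q
uniformLift-star {s = s} s≤1 =
  fold (λ p q → UniformLift s p → UniformLift s q) (λ st k → k ∘ uniformLift-step s≤1 st) id

lemma4 : (n : ℕ) → .{{_ : NonZero n}} → (k : ℕ) → 1 Data.Nat.≤ k → k Data.Nat.≤ n →
           (s : Fin n → ℚ) → (∀ i → 0ℚ ≤ s i × s i ≤ 1ℚ) → sumℚ s < ℕ→ℚ k →
           (p : State n) → Star Step (initial n k s) p → Final p →
           (∀ i → s i ≤ p i) × ∃ (λ v → ∀ j → p j < 1ℚ → p j - s j ≡ v)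
lemma4 n k _ _ s s∈[0,1] S<k p run _
  with uniformLift-star (proj₂ ∘ s∈[0,1]) run (uniformLift-initial n k s (<⇒≤ S<k))
... | v , lifted = proj₁ ∘ lifted , v , proj₂ ∘ lifted
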